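{- Let $m,n$ be positive integers with $3m\le n$. If $P_I,P_J\in\overline{\mathcal{P}}_m$ are distinct points of the same Hamming weight, this weight is at most $2m$, and the Hamming weight of $P_I\odot P_J$ is also at most $2m$, then there is $P_A\in\mathcal{P}_m$ such that $P_A\odot P_I$ and $P_A\odot P_J$ both belong to $\mathcal{P}_m$.
   Context: $\mathbb{F}$ is the two-element field, $V=\mathbb{F}^n$, $[n]=\{1,\dots,n\}$. For non-empty $I\subseteq[n]$, $P_I$ is the point of $\mathcal{P}(V)$ spanned by $\sum_{i\in I}e_i$, of Hamming weight $|I|$; for distinct points $P,Q$, $P\odot Q$ is the third point on the projective line through them, so $P_I\odot P_J=P_{I\triangle J}$. $\mathcal{P}_m$ is the set of all $P_I$ with $|I|=2m$, and $\overline{\mathcal{P}}_m$ is the set of all points $P\odot P'$ with $P,P'$ distinct points of $\mathcal{P}_m$ (equivalently, all $P_I$ with $|I|=2i$, $1\le i\le\min\{2m,n-2m\}$). -}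

module Defs where

open import Data.Nat using (ℕ; _*_)
open import Data.Bool using (_xor_)
open import Data.Vec using (zipWith)
open import Data.Fin.Subset using (Subset; ∣_∣; Nonempty)
open import Data.Product using (_×_; ∃₂)
open import Relation.Binary.PropositionalEquality using (_≡_; _≢_)

-- A point of P(F_2^n) is P_I for a non-empty I ⊆ [n]; we represent it by I.
-- Symmetric difference I △ J (coordinatewise xor).
_△_ : ∀ {n} → Subset n → Subset n → Subset n
_△_ = zipWith _xor_

_⊙_ : ∀ {n} → Subset n → Subset n → Subset n
I ⊙ J = I △ J

weight : ∀ {n} → Subset n → ℕ
weight I = ∣ I ∣

IsPoint : ∀ {n} → Subset n → Set
IsPoint I = Nonempty I

InP : ∀ {n} → ℕ → Subset n → Set
InP m I = IsPoint I × weight I ≡ 2 * m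

InPbar : ∀ {n} → ℕ → Subset n → Set
InPbar {n} m I = ∃₂ λ (K L : Subset n) → InP m K × InP m L × K ≢ L × I ≡ K ⊙ L

-- Split [n] into the four cells I ∩ J, I ∖ J, J ∖ I and ∁ (I ∪ J), of sizes c, a, a, e
-- (the middle cells agree because |I| = |J|).  Since I is the symmetric difference of two
-- sets of size 2m, |I| = 2i is even.  Any A of size 2m with |A ∩ I| = |A ∩ J| = i works,
-- because |A △ I| = |A| + |I| − 2|A ∩ I| = |A|.  Such an A is assembled cell by cell:
-- if i ≤ a, take i points from each middle cell and 2(m − i) points outside I ∪ J;
-- otherwise take both middle cells, i − a points of I ∩ J and 2m − i − a points outside.
-- The hypothesis 3m ≤ n is exactly what leaves enough room outside I ∪ J.
module Submission where

open import Defs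
open import Data.Nat using (ℕ; zero; suc; _+_; _*_; _∸_; _≤_; _<_; z≤n; s≤s; NonZero; >-nonZero⁻¹)
open import Data.Nat.Properties
open import Data.Nat.Tactic.RingSolver using (solve-∀)
open import Data.Fin.Subset
  using (Subset; inside; outside; ∣_∣; _∩_; _∪_; _─_; ∁; ⊥; _∈_; Nonempty)
open import Data.Fin.Subset.Properties
  using (∩-comm; ∣∁p∣≡n∸∣p∣; ∣p∣≤n; nonempty?; Empty-unique; ∣⊥∣≡0; ∉⊥)
open import Data.Vec using ([]; _∷_)
open import Data.Product using (_×_; _,_; ∃; map; proj₁)
open import Data.Sum using (inj₁; inj₂)
open import Function using (id)
open import Relation.Nullary using (yes; no; contradiction)
open import Relation.Binary.PropositionalEquality
  using (_≡_; _≢_; refl; sym; trans; cong; cong₂; subst; module ≡-Reasoning)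

private
  variable
    n : ℕ

∣p∣≡∣p∩q∣+∣p─q∣ : ∀ (p q : Subset n) → ∣ p ∣ ≡ ∣ p ∩ q ∣ + ∣ p ─ q ∣
∣p∣≡∣p∩q∣+∣p─q∣ []            []            = refl
∣p∣≡∣p∩q∣+∣p─q∣ (inside  ∷ p) (inside  ∷ q) = cong suc (∣p∣≡∣p∩q∣+∣p─q∣ p q)
∣p∣≡∣p∩q∣+∣p─q∣ (inside  ∷ p) (outside ∷ q) =
  trans (cong suc (∣p∣≡∣p∩q∣+∣p─q∣ p q)) (sym (+-suc _ _))
∣p∣≡∣p∩q∣+∣p─q∣ (outside ∷ p) (inside  ∷ q) = ∣p∣≡∣p∩q∣+∣p─q∣ p q
∣p∣≡∣p∩q∣+∣p─q∣ (outside ∷ p) (outside ∷ q) = ∣p∣≡∣p∩q∣+∣p─q∣ p q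

∣p△q∣≡∣p─q∣+∣q─p∣ : ∀ (p q : Subset n) → ∣ p △ q ∣ ≡ ∣ p ─ q ∣ + ∣ q ─ p ∣
∣p△q∣≡∣p─q∣+∣q─p∣ []            []            = refl
∣p△q∣≡∣p─q∣+∣q─p∣ (inside  ∷ p) (inside  ∷ q) = ∣p△q∣≡∣p─q∣+∣q─p∣ p q
∣p△q∣≡∣p─q∣+∣q─p∣ (inside  ∷ p) (outside ∷ q) = cong suc (∣p△q∣≡∣p─q∣+∣q─p∣ p q)
∣p△q∣≡∣p─q∣+∣q─p∣ (outside ∷ p) (inside  ∷ q) =
  trans (cong suc (∣p△q∣≡∣p─q∣+∣q─p∣ p q)) (sym (+-suc _ _))
∣p△q∣≡∣p─q∣+∣q─p∣ (outside ∷ p) (outside ∷ q) = ∣p△q∣≡∣p─q∣+∣q─p∣ p q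

∣p∪q∣≡∣p∣+∣q─p∣ : ∀ (p q : Subset n) → ∣ p ∪ q ∣ ≡ ∣ p ∣ + ∣ q ─ p ∣
∣p∪q∣≡∣p∣+∣q─p∣ []            []            = refl
∣p∪q∣≡∣p∣+∣q─p∣ (inside  ∷ p) (inside  ∷ q) = cong suc (∣p∪q∣≡∣p∣+∣q─p∣ p q)
∣p∪q∣≡∣p∣+∣q─p∣ (inside  ∷ p) (outside ∷ q) = cong suc (∣p∪q∣≡∣p∣+∣q─p∣ p q)
∣p∪q∣≡∣p∣+∣q─p∣ (outside ∷ p) (inside  ∷ q) =
  trans (cong suc (∣p∪q∣≡∣p∣+∣q─p∣ p q)) (sym (+-suc _ _))
∣p∪q∣≡∣p∣+∣q─p∣ (outside ∷ p) (outside ∷ q) = ∣p∪q∣≡∣p∣+∣q─p∣ p q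

∣p─q∣≡∣q─p∣ : ∀ (p q : Subset n) → ∣ p ∣ ≡ ∣ q ∣ → ∣ p ─ q ∣ ≡ ∣ q ─ p ∣
∣p─q∣≡∣q─p∣ p q ∣p∣≡∣q∣ = +-cancelˡ-≡ ∣ p ∩ q ∣ _ _ (begin
  ∣ p ∩ q ∣ + ∣ p ─ q ∣  ≡⟨ sym (∣p∣≡∣p∩q∣+∣p─q∣ p q) ⟩
  ∣ p ∣                  ≡⟨ ∣p∣≡∣q∣ ⟩
  ∣ q ∣                  ≡⟨ ∣p∣≡∣p∩q∣+∣p─q∣ q p ⟩
  ∣ q ∩ p ∣ + ∣ q ─ p ∣  ≡⟨ cong (λ r → ∣ r ∣ + ∣ q ─ p ∣) (∩-comm q p) ⟩
  ∣ p ∩ q ∣ + ∣ q ─ p ∣  ∎)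
  where open ≡-Reasoning

∣p∣≡∣q∣⇒∣p△q∣≡2∣p─q∣ : ∀ (p q : Subset n) → ∣ p ∣ ≡ ∣ q ∣ → ∣ p △ q ∣ ≡ 2 * ∣ p ─ q ∣
∣p∣≡∣q∣⇒∣p△q∣≡2∣p─q∣ p q ∣p∣≡∣q∣ = begin
  ∣ p △ q ∣              ≡⟨ ∣p△q∣≡∣p─q∣+∣q─p∣ p q ⟩
  ∣ p ─ q ∣ + ∣ q ─ p ∣  ≡⟨ cong (∣ p ─ q ∣ +_) (sym (∣p─q∣≡∣q─p∣ p q ∣p∣≡∣q∣)) ⟩
  ∣ p ─ q ∣ + ∣ p ─ q ∣  ≡⟨ cong (∣ p ─ q ∣ +_) (sym (+-identityʳ _)) ⟩
  2 * ∣ p ─ q ∣          ∎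
  where open ≡-Reasoning

∣p△q∣+2∣p∩q∣≡∣p∣+∣q∣ : ∀ (p q : Subset n) → ∣ p △ q ∣ + 2 * ∣ p ∩ q ∣ ≡ ∣ p ∣ + ∣ q ∣
∣p△q∣+2∣p∩q∣≡∣p∣+∣q∣ p q = begin
  ∣ p △ q ∣ + 2 * k          ≡⟨ cong (_+ 2 * k) (∣p△q∣≡∣p─q∣+∣q─p∣ p q) ⟩
  x + y + 2 * k              ≡⟨ regroup x y k ⟩
  (k + x) + (k + y)          ≡⟨ cong (λ r → (k + x) + (∣ r ∣ + y)) (∩-comm p q) ⟩
  (k + x) + (∣ q ∩ p ∣ + y)  ≡⟨ sym (cong₂ _+_ (∣p∣≡∣p∩q∣+∣p─q∣ p q) (∣p∣≡∣p∩q∣+∣p─q∣ q p)) ⟩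
  ∣ p ∣ + ∣ q ∣              ∎
  where
  open ≡-Reasoning
  k = ∣ p ∩ q ∣
  x = ∣ p ─ q ∣
  y = ∣ q ─ p ∣
  regroup : ∀ x y k → x + y + 2 * k ≡ (k + x) + (k + y)
  regroup = solve-∀

∣q∣≡2∣p∩q∣⇒∣p△q∣≡∣p∣ : ∀ (p q : Subset n) → ∣ q ∣ ≡ 2 * ∣ p ∩ q ∣ → ∣ p △ q ∣ ≡ ∣ p ∣
∣q∣≡2∣p∩q∣⇒∣p△q∣≡∣p∣ p q ∣q∣≡2k = +-cancelʳ-≡ (2 * ∣ p ∩ q ∣) _ _
  (trans (∣p△q∣+2∣p∩q∣≡∣p∣+∣q∣ p q) (cong (∣ p ∣ +_) ∣q∣≡2k))

p△p≡⊥ : ∀ (p : Subset n) → p △ p ≡ ⊥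
p△p≡⊥ []            = refl
p△p≡⊥ (inside  ∷ p) = cong (outside ∷_) (p△p≡⊥ p)
p△p≡⊥ (outside ∷ p) = cong (outside ∷_) (p△p≡⊥ p)

Nonempty[p△q]⇒p≢q : ∀ {p q : Subset n} → Nonempty (p △ q) → p ≢ q
Nonempty[p△q]⇒p≢q {p = p} (x , x∈p△p) refl = ∉⊥ (subst (x ∈_) (p△p≡⊥ p) x∈p△p)

0<∣p∣⇒Nonempty : ∀ (p : Subset n) → 0 < ∣ p ∣ → Nonempty p
0<∣p∣⇒Nonempty {n} p 0<∣p∣ with nonempty? p
... | yes ne = ne
... | no ¬ne = contradiction (trans (cong ∣_∣ (Empty-unique ¬ne)) (∣⊥∣≡0 n)) (>⇒≢ 0<∣p∣)

choose-from-cells : ∀ (p q : Subset n) (x y z w : ℕ) →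
  x ≤ ∣ p ∩ q ∣ → y ≤ ∣ p ─ q ∣ → z ≤ ∣ q ─ p ∣ → w ≤ ∣ ∁ (p ∪ q) ∣ →
  ∃ λ A → ∣ A ∣ ≡ x + y + z + w × ∣ A ∩ p ∣ ≡ x + y × ∣ A ∩ q ∣ ≡ x + z
choose-from-cells [] [] zero zero zero zero _ _ _ _ = [] , refl , refl , refl
choose-from-cells (inside ∷ p) (inside ∷ q) (suc x) y z w (s≤s x≤) y≤ z≤ w≤ =
  map (inside ∷_) (λ (∣A∣ , ∣A∩p∣ , ∣A∩q∣) → cong suc ∣A∣ , cong suc ∣A∩p∣ , cong suc ∣A∩q∣)
    (choose-from-cells p q x y z w x≤ y≤ z≤ w≤)
choose-from-cells (inside ∷ p) (outside ∷ q) x (suc y) z w x≤ (s≤s y≤) z≤ w≤ =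
  map (inside ∷_)
    (λ (∣A∣ , ∣A∩p∣ , ∣A∩q∣) →
      trans (cong suc ∣A∣) (sym (cong (λ t → t + z + w) (+-suc x y))) ,
      trans (cong suc ∣A∩p∣) (sym (+-suc x y)) ,
      ∣A∩q∣)
    (choose-from-cells p q x y z w x≤ y≤ z≤ w≤)
choose-from-cells (outside ∷ p) (inside ∷ q) x y (suc z) w x≤ y≤ (s≤s z≤) w≤ =
  map (inside ∷_)
    (λ (∣A∣ , ∣A∩p∣ , ∣A∩q∣) →
      trans (cong suc ∣A∣) (sym (cong (_+ w) (+-suc (x + y) z))) ,
      ∣A∩p∣ ,
      trans (cong suc ∣A∩q∣) (sym (+-suc x z)))
    (choose-from-cells p q x y z w x≤ y≤ z≤ w≤)
choose-from-cells (outside ∷ p) (outside ∷ q) x y z (suc w) x≤ y≤ z≤ (s≤s w≤) =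
  map (inside ∷_)
    (λ (∣A∣ , ∣A∩p∣ , ∣A∩q∣) → trans (cong suc ∣A∣) (sym (+-suc (x + y + z) w)) , ∣A∩p∣ , ∣A∩q∣)
    (choose-from-cells p q x y z w x≤ y≤ z≤ w≤)
-- Skipping a coordinate leaves all three counts unchanged definitionally.
choose-from-cells (inside ∷ p) (inside ∷ q) zero y z w _ y≤ z≤ w≤ =
  map (outside ∷_) id (choose-from-cells p q zero y z w z≤n y≤ z≤ w≤)
choose-from-cells (inside ∷ p) (outside ∷ q) x zero z w x≤ _ z≤ w≤ =
  map (outside ∷_) id (choose-from-cells p q x zero z w x≤ z≤n z≤ w≤)
choose-from-cells (outside ∷ p) (inside ∷ q) x y zero w x≤ y≤ _ w≤ =
  map (outside ∷_) id (choose-from-cells p q x y zero w x≤ y≤ z≤n w≤)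
choose-from-cells (outside ∷ p) (outside ∷ q) x y z zero x≤ y≤ z≤ _ =
  map (outside ∷_) id (choose-from-cells p q x y z zero x≤ y≤ z≤ z≤n)

CellQuotas : (c a e i m : ℕ) → Set
CellQuotas c a e i m = ∃ λ x → ∃ λ y → ∃ λ w →
  x ≤ c × y ≤ a × w ≤ e × x + y ≡ i × x + y + y + w ≡ 2 * m

cell-quotas-≤ : ∀ {c a e i m} → i ≤ a → i ≤ m → a ≤ m →
  3 * m ≤ 2 * i + a + e → CellQuotas c a e i m
cell-quotas-≤ {a = a} {e} {i} i≤a i≤m a≤m 3m≤ with m≤n⇒∃[o]m+o≡n i≤m
... | d , refl = 0 , i , d + d , z≤n , i≤a , d+d≤e , refl , total i d
  where
  open ≤-Reasoning
  total : ∀ i d → 0 + i + i + (d + d) ≡ 2 * (i + d)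
  total = solve-∀
  rearrange : ∀ i d → 2 * i + (i + d) + (d + d) ≡ 3 * (i + d)
  rearrange = solve-∀
  d+d≤e : d + d ≤ e
  d+d≤e = +-cancelˡ-≤ (2 * i + a) _ _ (begin
    2 * i + a + (d + d)        ≤⟨ +-monoˡ-≤ (d + d) (+-monoʳ-≤ (2 * i) a≤m) ⟩
    2 * i + (i + d) + (d + d)  ≡⟨ rearrange i d ⟩
    3 * (i + d)                ≤⟨ 3m≤ ⟩
    2 * i + a + e              ∎)

cell-quotas-≥ : ∀ {c a e i m} → a ≤ i → i ≤ m → c + a ≡ 2 * i →
  3 * m ≤ 2 * i + a + e → CellQuotas c a e i m
cell-quotas-≥ {c} {a} {e} {i} a≤i i≤m c+a≡2i 3m≤ with m≤n⇒∃[o]m+o≡n a≤i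
... | s , refl with m≤n⇒∃[o]m+o≡n i≤m
... | d , refl = s , a , d + (s + d) , s≤c , ≤-refl , w≤e , +-comm s a , total a s d
  where
  open ≤-Reasoning
  total : ∀ a s d → s + a + a + (d + (s + d)) ≡ 2 * (a + s + d)
  total = solve-∀
  rearrange : ∀ a s d → 2 * (a + s) + a + (d + (s + d)) + d ≡ 3 * (a + s + d)
  rearrange = solve-∀
  s≤c : s ≤ c
  s≤c = +-cancelʳ-≤ a s c (begin
    s + a                  ≤⟨ m≤m+n (s + a) (a + s) ⟩
    s + a + (a + s)        ≡⟨ cong (λ t → t + (a + s)) (+-comm s a) ⟩
    (a + s) + (a + s)      ≡⟨ cong ((a + s) +_) (sym (+-identityʳ (a + s))) ⟩
    2 * (a + s)            ≡⟨ sym c+a≡2i ⟩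
    c + a                  ∎)
  w≤e : d + (s + d) ≤ e
  w≤e = +-cancelˡ-≤ (2 * (a + s) + a) _ _ (begin
    2 * (a + s) + a + (d + (s + d))      ≤⟨ m≤m+n _ d ⟩
    2 * (a + s) + a + (d + (s + d)) + d  ≡⟨ rearrange a s d ⟩
    3 * (a + s + d)                      ≤⟨ 3m≤ ⟩
    2 * (a + s) + a + e                  ∎)

cell-quotas : ∀ {c a e i m} → c + a ≡ 2 * i → i ≤ m → a ≤ m →
  3 * m ≤ 2 * i + a + e → CellQuotas c a e i m
cell-quotas {a = a} {i = i} c+a≡2i i≤m a≤m 3m≤ with ≤-total i a
... | inj₁ i≤a = cell-quotas-≤ i≤a i≤m a≤m 3m≤
... | inj₂ a≤i = cell-quotas-≥ a≤i i≤m c+a≡2i 3m≤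

∃-bisecting-subset : ∀ m i (p q : Subset n) → ∣ p ∣ ≡ 2 * i → ∣ p ∣ ≡ ∣ q ∣ → i ≤ m →
  ∣ p △ q ∣ ≤ 2 * m → 3 * m ≤ n →
  ∃ λ A → ∣ A ∣ ≡ 2 * m × ∣ A ∩ p ∣ ≡ i × ∣ A ∩ q ∣ ≡ i
∃-bisecting-subset {n} m i p q ∣p∣≡2i ∣p∣≡∣q∣ i≤m ∣p△q∣≤2m 3m≤n =
  let x , y , w , x≤c , y≤a , w≤e , x+y≡i , x+2y+w≡2m = cell-quotas c+a≡2i i≤m a≤m 3m≤2i+a+e
      A , ∣A∣ , ∣A∩p∣ , ∣A∩q∣ =
        choose-from-cells p q x y y w x≤c y≤a (subst (y ≤_) a≡∣q─p∣ y≤a) w≤e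
  in A , trans ∣A∣ x+2y+w≡2m , trans ∣A∩p∣ x+y≡i , trans ∣A∩q∣ x+y≡i
  where
  open ≡-Reasoning
  a = ∣ p ─ q ∣
  e = ∣ ∁ (p ∪ q) ∣
  a≡∣q─p∣ : a ≡ ∣ q ─ p ∣
  a≡∣q─p∣ = ∣p─q∣≡∣q─p∣ p q ∣p∣≡∣q∣
  c+a≡2i : ∣ p ∩ q ∣ + a ≡ 2 * i
  c+a≡2i = trans (sym (∣p∣≡∣p∩q∣+∣p─q∣ p q)) ∣p∣≡2i
  a≤m : a ≤ m
  a≤m = *-cancelˡ-≤ 2 (subst (_≤ 2 * m) (∣p∣≡∣q∣⇒∣p△q∣≡2∣p─q∣ p q ∣p∣≡∣q∣) ∣p△q∣≤2m)
  n≡2i+a+e : n ≡ 2 * i + a + e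
  n≡2i+a+e = begin
    n                            ≡⟨ sym (m+[n∸m]≡n (∣p∣≤n (p ∪ q))) ⟩
    ∣ p ∪ q ∣ + (n ∸ ∣ p ∪ q ∣)  ≡⟨ cong (∣ p ∪ q ∣ +_) (sym (∣∁p∣≡n∸∣p∣ (p ∪ q))) ⟩
    ∣ p ∪ q ∣ + e                ≡⟨ cong (_+ e) (∣p∪q∣≡∣p∣+∣q─p∣ p q) ⟩
    ∣ p ∣ + ∣ q ─ p ∣ + e        ≡⟨ cong (λ t → t + ∣ q ─ p ∣ + e) ∣p∣≡2i ⟩
    2 * i + ∣ q ─ p ∣ + e        ≡⟨ cong (λ t → 2 * i + t + e) (sym a≡∣q─p∣) ⟩
    2 * i + a + e                ∎
  3m≤2i+a+e : 3 * m ≤ 2 * i + a + e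
  3m≤2i+a+e = subst (3 * m ≤_) n≡2i+a+e 3m≤n

∣p∣≡2m⇒InP : ∀ {m} → NonZero m → (p : Subset n) → ∣ p ∣ ≡ 2 * m → InP m p
∣p∣≡2m⇒InP {m = m} m≢0 p ∣p∣≡2m =
  0<∣p∣⇒Nonempty p (subst (0 <_) (sym ∣p∣≡2m) (>-nonZero⁻¹ (2 * m) {{m*n≢0 2 m {{_}} {{m≢0}}}})) ,
  ∣p∣≡2m

lemma4p4 : (m n : ℕ) → NonZero m → NonZero n → 3 * m ≤ n →
    (I J : Subset n) → InPbar m I → InPbar m J → I ≢ J →
    weight I ≡ weight J → weight I ≤ 2 * m → weight (I ⊙ J) ≤ 2 * m →
    ∃ λ (A : Subset n) → InP m A × A ≢ I × A ≢ J ×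
      InP m (A ⊙ I) × InP m (A ⊙ J)
lemma4p4 m n m≢0 _ 3m≤n I J (K , L , (_ , ∣K∣≡2m) , (_ , ∣L∣≡2m) , _ , I≡K△L) _ _
  ∣I∣≡∣J∣ ∣I∣≤2m ∣I△J∣≤2m =
  let A , ∣A∣≡2m , ∣A∩I∣≡i , ∣A∩J∣≡i = ∃-bisecting-subset m i I J ∣I∣≡2i ∣I∣≡∣J∣ i≤m ∣I△J∣≤2m 3m≤n
      ∣A△I∣≡2m = trans (∣q∣≡2∣p∩q∣⇒∣p△q∣≡∣p∣ A I (trans ∣I∣≡2i (cong (2 *_) (sym ∣A∩I∣≡i)))) ∣A∣≡2m
      ∣A△J∣≡2m = trans (∣q∣≡2∣p∩q∣⇒∣p△q∣≡∣p∣ A J (trans ∣J∣≡2i (cong (2 *_) (sym ∣A∩J∣≡i)))) ∣A∣≡2m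
      A△I-point = ∣p∣≡2m⇒InP m≢0 (A △ I) ∣A△I∣≡2m
      A△J-point = ∣p∣≡2m⇒InP m≢0 (A △ J) ∣A△J∣≡2m
  in A , ∣p∣≡2m⇒InP m≢0 A ∣A∣≡2m ,
     Nonempty[p△q]⇒p≢q (proj₁ A△I-point) , Nonempty[p△q]⇒p≢q (proj₁ A△J-point) ,
     A△I-point , A△J-point
  where
  i = ∣ K ─ L ∣
  ∣I∣≡2i : ∣ I ∣ ≡ 2 * i
  ∣I∣≡2i = trans (cong ∣_∣ I≡K△L) (∣p∣≡∣q∣⇒∣p△q∣≡2∣p─q∣ K L (trans ∣K∣≡2m (sym ∣L∣≡2m)))
  ∣J∣≡2i : ∣ J ∣ ≡ 2 * i
  ∣J∣≡2i = trans (sym ∣I∣≡∣J∣) ∣I∣≡2i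
  i≤m : i ≤ m
  i≤m = *-cancelˡ-≤ 2 (subst (_≤ 2 * m) ∣I∣≡2i ∣I∣≤2m)
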